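{- $n(6,4,16)=15$, and up to isomorphism there is exactly one $egr(15,6,4,16)$ graph; this graph is not bipartite.
   Context: All graphs are finite, simple (no loops or parallel edges) and connected. For integers $v,k,g,\lambda$, an $egr(v,k,g,\lambda)$ graph (edge-girth-regular graph) is a $k$-regular graph of girth $g$ on $v$ vertices such that every edge is contained in exactly $\lambda$ cycles of length $g$. $n(k,g,\lambda)$ denotes the smallest integer $v$ such that an $egr(v,k,g,\lambda)$ graph exists, and $n(k,g,\lambda)=\infty$ if no such graph exists. -}

module Defs where

open import Data.Nat using (ℕ; zero; suc; _<_; _≤ᵇ_)
open import Data.Bool using (Bool; true; false; _∧_; not)
open import Data.Fin using (Fin; _≟_)
open import Data.List using (List; []; _∷_; map; concatMap; length; filter; sum)
open import Data.List using () renaming ([_] to [_]ˡ)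
open import Data.Vec using (Vec; []; _∷_; last)
open import Data.Fin.Base using ()
open import Data.List.Base using ()
open import Data.Product using (Σ; _×_; Σ-syntax)
open import Function.Bundles using (_↔_; Inverse)
open import Relation.Nullary using (¬_)
open import Relation.Nullary.Decidable using (⌊_⌋)
open import Relation.Binary.PropositionalEquality using (_≡_)

allFin : (n : ℕ) → List (Fin n)
allFin n = Data.List.allFin n

record Graph (n : ℕ) : Set where
  field
    adj    : Fin n → Fin n → Bool
    sym    : ∀ u v → adj u v ≡ adj v u
    irrefl : ∀ u → adj u u ≡ false
open Graph public

countTrue : List Bool → ℕ
countTrue [] = 0
countTrue (true ∷ bs) = suc (countTrue bs)
countTrue (false ∷ bs) = countTrue bs

degree : ∀ {n} → Graph n → Fin n → ℕ
degree {n} G u = countTrue (map (adj G u) (allFin n))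

Regular : ∀ {n} → Graph n → ℕ → Set
Regular G k = ∀ u → degree G u ≡ k

data Reach {n : ℕ} (G : Graph n) : Fin n → Fin n → Set where
  here : ∀ {u} → Reach G u u
  step : ∀ {u w v} → adj G u w ≡ true → Reach G w v → Reach G u v

Connected : ∀ {n} → Graph n → Set
Connected {n} G = (u v : Fin n) → Reach G u v

notIn : ∀ {n m} → Fin n → Vec (Fin n) m → Bool
notIn x [] = true
notIn x (y ∷ ys) = not ⌊ x ≟ y ⌋ ∧ notIn x ys

allDistinct : ∀ {n m} → Vec (Fin n) m → Bool
allDistinct [] = true
allDistinct (x ∷ xs) = notIn x xs ∧ allDistinct xs

isWalk : ∀ {n m} → Graph n → Vec (Fin n) m → Bool
isWalk G [] = true
isWalk G (x ∷ []) = true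
isWalk G (x ∷ y ∷ r) = adj G x y ∧ isWalk G (y ∷ r)

closes : ∀ {n m} → Graph n → Vec (Fin n) m → Bool
closes G [] = true
closes G (x ∷ r) = adj G (last (x ∷ r)) x

isCycle : ∀ {n m} → Graph n → Vec (Fin n) m → Bool
isCycle {n} {m} G xs = (3 ≤ᵇ m) ∧ (allDistinct xs ∧ (isWalk G xs ∧ closes G xs))

startsWith : ∀ {n m} → Vec (Fin n) m → Fin n → Fin n → Bool
startsWith (x ∷ y ∷ _) u v = ⌊ x ≟ u ⌋ ∧ ⌊ y ≟ v ⌋
startsWith _ u v = false

allVecs : (m n : ℕ) → List (Vec (Fin n) m)
allVecs zero n = [ [] ]ˡ
allVecs (suc m) n = concatMap (λ i → map (i ∷_) (allVecs m n)) (allFin n)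

HasCycleOfLength : ∀ {n} → Graph n → ℕ → Set
HasCycleOfLength {n} G m = Σ[ xs ∈ Vec (Fin n) m ] isCycle G xs ≡ true

Girth : ∀ {n} → Graph n → ℕ → Set
Girth G g = HasCycleOfLength G g × (∀ m → m < g → ¬ HasCycleOfLength G m)

-- Number of cycles of length g containing the edge {u,v}.
-- Each such cycle corresponds to exactly one sequence (x_0,...,x_{g-1})
-- with x_0 = u, x_1 = v (start at u, traverse the edge u→v first).
cyclesThrough : ∀ {n} → Graph n → ℕ → Fin n → Fin n → ℕ
cyclesThrough {n} G g u v =
  countTrue (map (λ xs → isCycle G xs ∧ startsWith xs u v) (allVecs g n))

EdgeInCycles : ∀ {n} → Graph n → ℕ → ℕ → Set
EdgeInCycles G g l = ∀ u v → adj G u v ≡ true → cyclesThrough G g u v ≡ l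

-- egr(v,k,g,λ) graph (with v = n, the number of vertices)
IsEGR : ∀ {n} → Graph n → ℕ → ℕ → ℕ → Set
IsEGR G k g l = Connected G × Regular G k × Girth G g × EdgeInCycles G g l

NEq : ℕ → ℕ → ℕ → ℕ → Set
NEq k g l v = (Σ[ G ∈ Graph v ] IsEGR G k g l)
            × (∀ w → w < v → (G : Graph w) → ¬ IsEGR G k g l)

Isomorphic : ∀ {n m} → Graph n → Graph m → Set
Isomorphic {n} {m} G H =
  Σ[ f ∈ Fin n ↔ Fin m ] (∀ u v → adj H (Inverse.to f u) (Inverse.to f v) ≡ adj G u v)

Bipartite : ∀ {n} → Graph n → Set
Bipartite {n} G = Σ[ c ∈ (Fin n → Bool) ]
  (∀ u v → adj G u v ≡ true → ¬ (c u ≡ c v))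

-- Fix an edge uv of an egr(n,6,4,16) graph G.  Girth 4 makes G triangle-free, so A = N(u) and
-- B = N(v) are disjoint sets of six vertices; let R be the remaining n - 12 vertices.  A walk
-- v a w u is a 4-cycle through uv unless a = u or w = v, so there are at most 16 + 6 + 5 = 27 such
-- walks, and they are exactly the pairs (w, a) with w ∈ A, a ∈ B, w ~ a.  Of the 2·6² pairs (w, a)
-- with a ∈ A ∪ B and w ~ a, at most 27 + 27 therefore have w ∈ A ∪ B, while each w ∈ R accounts
-- for at most six: |R| ≥ 3 and n ≥ 15.
--
-- When n = 15 every inequality is tight.  Each r ∈ R has three neighbours in A and three in B, R is
-- independent, and a vertex of A either has the neighbourhood of v or is adjacent to all of R
-- (symmetrically for B).  The twins of u, the twins of v, the rest of B, R and the rest of A are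
-- five classes of at most three vertices each, adjacent exactly as consecutive vertices of a
-- pentagon, so G is the blow-up C₅[3].  Conversely C₅[3] is such a graph, and it has 5-cycles.

module Submission where

open import Defs hiding (sym)
open Graph using () renaming (sym to adj-sym)
open import Data.Bool using (Bool; true; false; _∧_; _∨_; not)
import Data.Bool as Bool
open import Data.Bool.Properties using (∧-comm; ∧-zeroʳ; ∧-identityʳ; ∨-comm; ⇔→≡)
open import Data.Empty using (⊥; ⊥-elim)
open import Data.Fin using (Fin; zero; suc; _≟_; toℕ; quotient; combine; fromℕ<; punchOut)
  renaming (_<_ to _<ᶠ_)
open import Data.Fin.Patterns using (0F; 1F; 2F; 3F; 4F)
open import Data.Fin.Properties
  using (all?; any?; suc-injective; remQuot-combine; combine-injective; toℕ-fromℕ<; punchOut-injective; injective⇒≤)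
  renaming (_<?_ to _<ᶠ?_; <-irrefl to <ᶠ-irrefl; <-trans to <ᶠ-trans; <-cmp to <ᶠ-cmp)
open import Data.List using (List; []; _∷_; map; concat; tabulate; _++_)
open import Data.List.Properties using (map-++; map-∘; map-cong)
open import Data.Nat using (ℕ; zero; suc; _+_; _*_; _≤_; _<_; z≤n; s≤s; _≤ᵇ_; _≡ᵇ_; _%_)
import Data.Nat.Properties as ℕ
open import Data.Nat.Properties
  using (+-*-semiring; ≤-refl; ≤-trans; ≤-reflexive; ≤-antisym; <-irrefl; ≤⇒≤ᵇ; <⇒≱; m≤m+n; m≤n+m;
         +-mono-≤; +-mono-<-≤; +-mono-≤-<; +-monoˡ-≤; +-monoʳ-≤; +-cancelˡ-≤; +-cancelʳ-≤; +-cancelˡ-≡;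
         +-identityʳ; +-assoc; +-comm; +-suc; *-comm; *-zeroʳ; *-identityˡ; *-identityʳ; *-distribʳ-+;
         *-monoʳ-≤; module ≤-Reasoning)
open import Data.Product using (Σ; Σ-syntax; ∃-syntax; _×_; _,_; proj₁; proj₂)
open import Data.Sum using (_⊎_; inj₁; inj₂)
open import Data.Vec using (Vec; []; _∷_)
open import Function using (_∘_)
open import Function.Bundles using (Inverse; mk⇔; mk⤖)
open import Function.Consequences.Propositional using (strictlySurjective⇒surjective)
open import Function.Properties.Bijection using (⤖⇒↔)
open import Function.Properties.Inverse using (↔-sym; ↔-trans)
open import Relation.Binary.Definitions using (Tri; tri<; tri≈; tri>)
open import Relation.Binary.PropositionalEquality
open import Relation.Nullary using (¬_; Dec; yes; no)
open import Relation.Nullary.Decidable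
  using (⌊_⌋; isYes≗does; dec-true; dec-false; toWitness; _→-dec_; _×-dec_; _⊎-dec_)

open import Algebra.Properties.Semiring.Sum +-*-semiring
  using (sum; sum-syntax; sum-cong-≗; ∑-distrib-+; ∑-comm; *-distribˡ-sum; *-distribʳ-sum)

∧-true : ∀ {a b} → a ∧ b ≡ true → a ≡ true × b ≡ true
∧-true {true} {true} _ = refl , refl

isYes⇒ : ∀ {P : Set} {d : Dec P} → ⌊ d ⌋ ≡ true → P
isYes⇒ {d = yes p} _ = p

isYes⇐ : ∀ {P : Set} (d : Dec P) → P → ⌊ d ⌋ ≡ true
isYes⇐ d p = trans (isYes≗does d) (dec-true d p)

isNo⇐ : ∀ {P : Set} (d : Dec P) → ¬ P → ⌊ d ⌋ ≡ false
isNo⇐ d ¬p = trans (isYes≗does d) (dec-false d ¬p)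

≟-refl : ∀ {n} (i : Fin n) → ⌊ i ≟ i ⌋ ≡ true
≟-refl i = isYes⇐ (i ≟ i) refl

≟-≢ : ∀ {n} {i j : Fin n} → ¬ i ≡ j → ⌊ i ≟ j ⌋ ≡ false
≟-≢ {i = i} {j} = isNo⇐ (i ≟ j)

𝟙 : Bool → ℕ
𝟙 true = 1
𝟙 false = 0

count : ∀ {n} → (Fin n → Bool) → ℕ
count {n} P = ∑[ i < n ] 𝟙 (P i)

𝟙-∧ : ∀ a b → 𝟙 (a ∧ b) ≡ 𝟙 a * 𝟙 b
𝟙-∧ true b = sym (+-identityʳ _)
𝟙-∧ false b = refl

𝟙-mono : ∀ {a b} → (a ≡ true → b ≡ true) → 𝟙 a ≤ 𝟙 b
𝟙-mono {true} a⇒b rewrite a⇒b refl = ≤-refl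
𝟙-mono {false} _ = z≤n

𝟙-injective : ∀ {a b} → 𝟙 a ≡ 𝟙 b → a ≡ b
𝟙-injective {true} {true} _ = refl
𝟙-injective {false} {false} _ = refl

𝟙-split : ∀ a b → 𝟙 a ≡ 𝟙 (b ∧ a) + 𝟙 (not b ∧ a)
𝟙-split a true = sym (+-identityʳ _)
𝟙-split a false = refl

𝟙-*-cong : ∀ a {x y} → (a ≡ true → x ≡ y) → 𝟙 a * x ≡ 𝟙 a * y
𝟙-*-cong true x≡y = cong (1 *_) (x≡y refl)
𝟙-*-cong false _ = refl

∑-distrib-+₃ : ∀ {n} (f g h : Fin n → ℕ) → ∑[ i < n ] (f i + g i + h i) ≡ sum f + sum g + sum h
∑-distrib-+₃ f g h = trans (∑-distrib-+ (λ i → f i + g i) h) (cong (_+ sum h) (∑-distrib-+ f g))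

sum-const : ∀ n c → ∑[ i < n ] c ≡ n * c
sum-const zero c = refl
sum-const (suc n) c = cong (c +_) (sum-const n c)

sum-zero : ∀ {n} (f : Fin n → ℕ) → (∀ i → f i ≡ 0) → sum f ≡ 0
sum-zero {n} f f≗0 = trans (sum-cong-≗ f≗0) (trans (sum-const n 0) (*-zeroʳ n))

sum-single : ∀ {n} (f : Fin n → ℕ) a → (∀ i → ¬ i ≡ a → f i ≡ 0) → sum f ≡ f a
sum-single {suc n} f zero off = trans (cong (f zero +_) (sum-zero _ λ i → off (suc i) λ ())) (+-identityʳ _)
sum-single {suc n} f (suc a) off =
  trans (cong (_+ sum (f ∘ suc)) (off zero λ ()))
        (sum-single (f ∘ suc) a (λ i i≢a → off (suc i) (i≢a ∘ suc-injective)))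

sum-mono : ∀ {n} {f g : Fin n → ℕ} → (∀ i → f i ≤ g i) → sum f ≤ sum g
sum-mono {zero} _ = z≤n
sum-mono {suc n} f≤g = +-mono-≤ (f≤g zero) (sum-mono (f≤g ∘ suc))

sum-mono-< : ∀ {n} {f g : Fin n → ℕ} a → (∀ i → f i ≤ g i) → f a < g a → sum f < sum g
sum-mono-< {suc n} zero f≤g lt = +-mono-<-≤ lt (sum-mono (f≤g ∘ suc))
sum-mono-< {suc n} (suc a) f≤g lt = +-mono-≤-< (f≤g zero) (sum-mono-< a (f≤g ∘ suc) lt)

sum-mono-tight : ∀ {n} {f g : Fin n → ℕ} → (∀ i → f i ≤ g i) → sum g ≤ sum f → ∀ i → f i ≡ g i
sum-mono-tight {suc n} {f} {g} f≤g g≤f zero =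
  ≤-antisym (f≤g zero) (+-cancelʳ-≤ _ _ _ (≤-trans g≤f (+-monoʳ-≤ (f zero) (sum-mono (f≤g ∘ suc)))))
sum-mono-tight {suc n} {f} {g} f≤g g≤f (suc i) =
  sum-mono-tight (f≤g ∘ suc) (+-cancelˡ-≤ (g zero) _ _ (≤-trans g≤f (+-monoˡ-≤ _ (f≤g zero)))) i

count-pos : ∀ {n} (P : Fin n → Bool) → 0 < count P → Σ[ i ∈ Fin n ] P i ≡ true
count-pos {suc n} P pos with P zero in P0
... | true = zero , P0
... | false with count-pos (P ∘ suc) pos
...   | i , Pi = suc i , Pi

count-mono : ∀ {n} {P Q : Fin n → Bool} → (∀ i → P i ≡ true → Q i ≡ true) → count P ≤ count Q
count-mono P⇒Q = sum-mono (λ i → 𝟙-mono (P⇒Q i))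

count-mono-tight : ∀ {n} {P Q : Fin n → Bool} → (∀ i → P i ≡ true → Q i ≡ true) → count Q ≤ count P →
                   ∀ i → Q i ≡ true → P i ≡ true
count-mono-tight P⇒Q Q≤P i Qi =
  𝟙-injective (trans (sum-mono-tight (λ j → 𝟙-mono (P⇒Q j)) Q≤P i) (cong 𝟙 Qi))

countTrue-∷ : ∀ b bs → countTrue (b ∷ bs) ≡ 𝟙 b + countTrue bs
countTrue-∷ true bs = refl
countTrue-∷ false bs = refl
countTrue-++ : ∀ xs ys → countTrue (xs ++ ys) ≡ countTrue xs + countTrue ys
countTrue-++ [] ys = refl
countTrue-++ (b ∷ xs) ys = begin
  countTrue (b ∷ xs ++ ys)              ≡⟨ countTrue-∷ b (xs ++ ys) ⟩
  𝟙 b + countTrue (xs ++ ys)            ≡⟨ cong (𝟙 b +_) (countTrue-++ xs ys) ⟩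
  𝟙 b + (countTrue xs + countTrue ys)   ≡⟨ sym (+-assoc (𝟙 b) _ _) ⟩
  𝟙 b + countTrue xs + countTrue ys     ≡⟨ cong (_+ countTrue ys) (sym (countTrue-∷ b xs)) ⟩
  countTrue (b ∷ xs) + countTrue ys     ∎
  where open ≡-Reasoning

countTrue-map-false : ∀ {A : Set} (F : A → Bool) → (∀ x → F x ≡ false) → ∀ xs → countTrue (map F xs) ≡ 0
countTrue-map-false F F≡false [] = refl
countTrue-map-false F F≡false (x ∷ xs) rewrite F≡false x = countTrue-map-false F F≡false xs

countTrue-tabulate : ∀ {A : Set} {n} (F : A → Bool) (g : Fin n → A) →
                     countTrue (map F (tabulate g)) ≡ ∑[ i < n ] 𝟙 (F (g i))
countTrue-tabulate {n = zero} F g = refl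
countTrue-tabulate {n = suc n} F g =
  trans (countTrue-∷ (F (g zero)) _) (cong (𝟙 (F (g zero)) +_) (countTrue-tabulate F (g ∘ suc)))

degree≡count : ∀ {n} (G : Graph n) u → degree G u ≡ count (adj G u)
degree≡count G u = countTrue-tabulate (adj G u) (λ i → i)

countTrue-concat-tabulate : ∀ {A B : Set} {n} (F : B → Bool) (h : A → List B) (g : Fin n → A) →
  countTrue (map F (concat (map h (tabulate g)))) ≡ ∑[ i < n ] countTrue (map F (h (g i)))
countTrue-concat-tabulate {n = zero} F h g = refl
countTrue-concat-tabulate {n = suc n} F h g = begin
  countTrue (map F (h (g zero) ++ rest))                ≡⟨ cong countTrue (map-++ F (h (g zero)) rest) ⟩
  countTrue (map F (h (g zero)) ++ map F rest)          ≡⟨ countTrue-++ (map F (h (g zero))) (map F rest) ⟩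
  countTrue (map F (h (g zero))) + countTrue (map F rest)
    ≡⟨ cong (countTrue (map F (h (g zero))) +_) (countTrue-concat-tabulate F h (g ∘ suc)) ⟩
  ∑[ i < suc n ] countTrue (map F (h (g i)))            ∎
  where
  open ≡-Reasoning
  rest = concat (map h (tabulate (g ∘ suc)))

countTrue-allVecs : ∀ {n} m (F : Vec (Fin n) (suc m) → Bool) →
  countTrue (map F (allVecs (suc m) n)) ≡ ∑[ i < n ] countTrue (map (F ∘ (i ∷_)) (allVecs m n))
countTrue-allVecs {n} m F =
  trans (countTrue-concat-tabulate F (λ i → map (i ∷_) (allVecs m n)) (λ i → i))
        (sum-cong-≗ λ i → cong countTrue (sym (map-∘ {g = F} {f = i ∷_} (allVecs m n))))

cyclesThrough≡ : ∀ {n} (G : Graph n) m u v →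
  cyclesThrough G (suc (suc m)) u v ≡ countTrue (map (λ xs → isCycle G (u ∷ v ∷ xs)) (allVecs m n))
cyclesThrough≡ {n} G m u v = begin
  cyclesThrough G (suc (suc m)) u v
    ≡⟨ countTrue-allVecs (suc m) F ⟩
  ∑[ i < n ] countTrue (map (F ∘ (i ∷_)) (allVecs (suc m) n))
    ≡⟨ sum-cong-≗ (λ i → countTrue-allVecs m (F ∘ (i ∷_))) ⟩
  ∑[ i < n ] ∑[ j < n ] countTrue (map (λ xs → F (i ∷ j ∷ xs)) (allVecs m n))
    ≡⟨ sum-single _ u (λ i i≢u → sum-zero _ λ j → off i j (i≢u ∘ proj₁)) ⟩
  ∑[ j < n ] countTrue (map (λ xs → F (u ∷ j ∷ xs)) (allVecs m n))
    ≡⟨ sum-single _ v (λ j j≢v → off u j (j≢v ∘ proj₂)) ⟩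
  countTrue (map (λ xs → F (u ∷ v ∷ xs)) (allVecs m n))
    ≡⟨ cong countTrue (map-cong (λ xs → on xs) (allVecs m n)) ⟩
  countTrue (map (λ xs → isCycle G (u ∷ v ∷ xs)) (allVecs m n)) ∎
  where
  open ≡-Reasoning
  F : Vec (Fin n) (suc (suc m)) → Bool
  F xs = isCycle G xs ∧ startsWith xs u v
  wrongStart : ∀ i j → ¬ (i ≡ u × j ≡ v) → ⌊ i ≟ u ⌋ ∧ ⌊ j ≟ v ⌋ ≡ false
  wrongStart i j ne with i ≟ u | j ≟ v
  ... | yes refl | yes refl = ⊥-elim (ne (refl , refl))
  ... | yes _ | no _ = refl
  ... | no _ | _ = refl
  off : ∀ i j → ¬ (i ≡ u × j ≡ v) → countTrue (map (λ xs → F (i ∷ j ∷ xs)) (allVecs m n)) ≡ 0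
  off i j ne = countTrue-map-false _ (λ xs → trans (cong (isCycle G (i ∷ j ∷ xs) ∧_) (wrongStart i j ne))
                                                  (∧-zeroʳ _)) (allVecs m n)
  on : ∀ xs → F (u ∷ v ∷ xs) ≡ isCycle G (u ∷ v ∷ xs)
  on xs rewrite ≟-refl u | ≟-refl v = ∧-identityʳ _

cyclesThrough₄ : ∀ {n} (G : Graph n) u v →
  cyclesThrough G 4 u v ≡ ∑[ x < n ] ∑[ y < n ] 𝟙 (isCycle G (u ∷ v ∷ x ∷ y ∷ []))
cyclesThrough₄ {n} G u v = begin
  cyclesThrough G 4 u v ≡⟨ cyclesThrough≡ G 2 u v ⟩
  countTrue (map (λ xs → isCycle G (u ∷ v ∷ xs)) (allVecs 2 n))
    ≡⟨ countTrue-allVecs {n} 1 (λ xs → isCycle G (u ∷ v ∷ xs)) ⟩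
  ∑[ x < n ] countTrue (map (λ xs → isCycle G (u ∷ v ∷ x ∷ xs)) (allVecs 1 n))
    ≡⟨ sum-cong-≗ (λ x → trans (countTrue-allVecs {n} 0 (λ xs → isCycle G (u ∷ v ∷ x ∷ xs)))
                                  (sum-cong-≗ λ y → single (isCycle G (u ∷ v ∷ x ∷ y ∷ [])))) ⟩
  ∑[ x < n ] ∑[ y < n ] 𝟙 (isCycle G (u ∷ v ∷ x ∷ y ∷ [])) ∎
  where
  open ≡-Reasoning
  single : ∀ b → countTrue (b ∷ []) ≡ 𝟙 b
  single b = trans (countTrue-∷ b []) (+-identityʳ (𝟙 b))

module _ {n} (G : Graph n) where

  TriangleFree : Set
  TriangleFree = ∀ a b c → adj G a b ≡ true → adj G b c ≡ true → adj G c a ≡ true → ⊥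

  adj⇒≢ : ∀ {a b} → adj G a b ≡ true → ¬ a ≡ b
  adj⇒≢ {a} ab refl with () ← trans (sym ab) (irrefl G a)

  adj-swap : ∀ {a b x} → adj G a b ≡ x → adj G b a ≡ x
  adj-swap {a} {b} ab = trans (adj-sym G b a) ab

  isCycle₃ : ∀ {a b c} → adj G a b ≡ true → adj G b c ≡ true → adj G c a ≡ true →
             isCycle G (a ∷ b ∷ c ∷ []) ≡ true
  isCycle₃ ab bc ca
    rewrite ≟-≢ (adj⇒≢ ab) | ≟-≢ (adj⇒≢ ca ∘ sym) | ≟-≢ (adj⇒≢ bc) | ab | bc | ca = refl

  isCycle₄ : ∀ {u v a w} → adj G u v ≡ true → adj G v a ≡ true → adj G a w ≡ true → adj G w u ≡ true →
             ¬ a ≡ u → ¬ w ≡ v → isCycle G (u ∷ v ∷ a ∷ w ∷ []) ≡ true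
  isCycle₄ uv va aw wu a≢u w≢v
    rewrite ≟-≢ (adj⇒≢ uv) | ≟-≢ (a≢u ∘ sym) | ≟-≢ (adj⇒≢ wu ∘ sym)
          | ≟-≢ (adj⇒≢ va) | ≟-≢ (w≢v ∘ sym) | ≟-≢ (adj⇒≢ aw) | uv | va | aw | wu = refl

  isCycle⇒closedWalk : ∀ {m} (xs : Vec (Fin n) m) → isCycle G xs ≡ true →
                       isWalk G xs ≡ true × closes G xs ≡ true
  isCycle⇒closedWalk {m} xs cyc =
    ∧-true {isWalk G xs} (proj₂ (∧-true {allDistinct xs} (proj₂ (∧-true {3 ≤ᵇ m} cyc))))

  triangle : ∀ a b c → isCycle G (a ∷ b ∷ c ∷ []) ≡ true →
             adj G a b ≡ true × adj G b c ≡ true × adj G c a ≡ true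
  triangle a b c cyc =
    let walk , ca = isCycle⇒closedWalk (a ∷ b ∷ c ∷ []) cyc
        ab , bc = ∧-true {adj G a b} walk
    in ab , proj₁ (∧-true {adj G b c} bc) , ca

  cycle⇒edge : ∀ {m} (xs : Vec (Fin n) (suc (suc m))) → isCycle G xs ≡ true → ∃[ u ] ∃[ v ] adj G u v ≡ true
  cycle⇒edge (x ∷ y ∷ xs) cyc =
    x , y , proj₁ (∧-true {adj G x y} (proj₁ (isCycle⇒closedWalk (x ∷ y ∷ xs) cyc)))

  girth4⇒triangleFree : Girth G 4 → TriangleFree
  girth4⇒triangleFree (_ , noShort) a b c ab bc ca = noShort 3 ≤-refl ((a ∷ b ∷ c ∷ []) , isCycle₃ ab bc ca)

  triangleFree⇒noShortCycle : TriangleFree → ∀ m → m < 4 → ¬ HasCycleOfLength G m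
  triangleFree⇒noShortCycle triangleFree 0 _ (_ , ())
  triangleFree⇒noShortCycle triangleFree 1 _ (_ , ())
  triangleFree⇒noShortCycle triangleFree 2 _ (_ , ())
  triangleFree⇒noShortCycle triangleFree 3 _ ((a ∷ b ∷ c ∷ []) , cyc) =
    let ab , bc , ca = triangle a b c cyc in triangleFree a b c ab bc ca
  triangleFree⇒noShortCycle triangleFree (suc (suc (suc (suc m)))) (s≤s (s≤s (s≤s (s≤s ()))))

  Twins : Fin n → Fin n → Set
  Twins a b = ∀ z → adj G a z ≡ adj G b z

  twins? : ∀ a b → Dec (Twins a b)
  twins? a b = all? (λ z → adj G a z Bool.≟ adj G b z)

module _ {n m} {G : Graph n} {H : Graph m} where

  ≅-sym : Isomorphic G H → Isomorphic H G
  ≅-sym (f , f-adj) = ↔-sym f , λ x y →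
    trans (sym (f-adj (from x) (from y))) (cong₂ (adj H) (strictlyInverseˡ x) (strictlyInverseˡ y))
    where open Inverse f

  Bipartite-pullback : Isomorphic G H → Bipartite H → Bipartite G
  Bipartite-pullback (f , f-adj) (colour , proper) =
    colour ∘ Inverse.to f , λ a b ab → proper _ _ (trans (f-adj a b) ab)

≅-trans : ∀ {n m k} {G : Graph n} {H : Graph m} {I : Graph k} →
          Isomorphic G H → Isomorphic H I → Isomorphic G I
≅-trans (f , f-adj) (g , g-adj) =
  ↔-trans f g , λ a b → trans (g-adj (Inverse.to f a) (Inverse.to f b)) (f-adj a b)

pentagon⇒¬Bipartite : ∀ {n} (G : Graph n) {a b c d e} →
  adj G a b ≡ true → adj G b c ≡ true → adj G c d ≡ true → adj G d e ≡ true → adj G e a ≡ true →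
  ¬ Bipartite G
pentagon⇒¬Bipartite G ab bc cd de ea (colour , proper) =
  proper _ _ ea (sym (trans (alternate (proper _ _ ab) (proper _ _ bc))
                             (alternate (proper _ _ cd) (proper _ _ de))))
  where
  alternate : ∀ {x y z : Bool} → ¬ x ≡ y → ¬ y ≡ z → x ≡ z
  alternate {false} {false} x≢y _ = ⊥-elim (x≢y refl)
  alternate {true} {true} x≢y _ = ⊥-elim (x≢y refl)
  alternate {_} {false} {false} _ y≢z = ⊥-elim (y≢z refl)
  alternate {_} {true} {true} _ y≢z = ⊥-elim (y≢z refl)
  alternate {false} {true} {false} _ _ = refl
  alternate {true} {false} {true} _ _ = refl

module _ {n} (G : Graph n) where

  degreeIn : (Fin n → Bool) → Fin n → ℕ
  degreeIn S w = count (λ a → adj G w a ∧ S a)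

  Outside : Fin n → Fin n → Fin n → Bool
  Outside u v w = not (adj G u w) ∧ not (adj G v w)

  innerDegree : Fin n → Fin n → Fin n → ℕ
  innerDegree u v w = degreeIn (adj G u) w + degreeIn (adj G v) w

  Outside⇒nonadjacent : ∀ {u v w} → Outside u v w ≡ true → adj G u w ≡ false × adj G v w ≡ false
  Outside⇒nonadjacent {u} {v} {w} out with adj G u w | adj G v w
  ... | false | false = refl , refl

  Outside-comm : ∀ u v w → Outside v u w ≡ Outside u v w
  Outside-comm u v w = ∧-comm (not (adj G v w)) (not (adj G u w))

  walks₃ : Fin n → Fin n → ℕ
  walks₃ x y = ∑[ a < n ] ∑[ w < n ] 𝟙 (adj G x a ∧ (adj G a w ∧ adj G w y))

  degreeIn-comm : ∀ x y → degreeIn (adj G x) y ≡ degreeIn (adj G y) x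
  degreeIn-comm x y = sum-cong-≗ λ a → cong 𝟙 (∧-comm (adj G y a) (adj G x a))

  walks₃≡ : ∀ x y → walks₃ x y ≡ ∑[ w < n ] (𝟙 (adj G y w) * degreeIn (adj G x) w)
  walks₃≡ x y = begin
    ∑[ a < n ] ∑[ w < n ] 𝟙 (adj G x a ∧ (adj G a w ∧ adj G w y))
      ≡⟨ ∑-comm (λ a w → 𝟙 (adj G x a ∧ (adj G a w ∧ adj G w y))) ⟩
    ∑[ w < n ] ∑[ a < n ] 𝟙 (adj G x a ∧ (adj G a w ∧ adj G w y))
      ≡⟨ sum-cong-≗ (λ w → sum-cong-≗ λ a → reorder (adj G x a) (adj-sym G a w) (adj-sym G w y)) ⟩
    ∑[ w < n ] ∑[ a < n ] (𝟙 (adj G y w) * 𝟙 (adj G w a ∧ adj G x a))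
      ≡⟨ sum-cong-≗ (λ w → sym (*-distribˡ-sum (𝟙 (adj G y w)) (λ a → 𝟙 (adj G w a ∧ adj G x a)))) ⟩
    ∑[ w < n ] (𝟙 (adj G y w) * degreeIn (adj G x) w)                 ∎
    where
    open ≡-Reasoning
    reorder : ∀ p {q q′ r r′} → q ≡ q′ → r ≡ r′ → 𝟙 (p ∧ (q ∧ r)) ≡ 𝟙 r′ * 𝟙 (q′ ∧ p)
    reorder true {true} {r = true} refl refl = refl
    reorder true {true} {r = false} refl refl = refl
    reorder true {false} {r = r} refl refl = sym (*-zeroʳ (𝟙 r))
    reorder false {q} {r = r} refl refl rewrite ∧-zeroʳ q = sym (*-zeroʳ (𝟙 r))

  ∑degreeIn : ∀ {k} → (∀ w → count (adj G w) ≡ k) → ∀ x → ∑[ w < n ] degreeIn (adj G x) w ≡ k * k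
  ∑degreeIn {k} regular x = begin
    ∑[ w < n ] ∑[ a < n ] 𝟙 (adj G w a ∧ adj G x a)    ≡⟨ ∑-comm (λ w a → 𝟙 (adj G w a ∧ adj G x a)) ⟩
    ∑[ a < n ] ∑[ w < n ] 𝟙 (adj G w a ∧ adj G x a)
      ≡⟨ sum-cong-≗ (λ a → sum-cong-≗ λ w → trans (cong (λ b → 𝟙 (b ∧ adj G x a)) (adj-sym G w a))
                                                    (trans (𝟙-∧ (adj G a w) _) (*-comm (𝟙 (adj G a w)) _))) ⟩
    ∑[ a < n ] ∑[ w < n ] (𝟙 (adj G x a) * 𝟙 (adj G a w))
      ≡⟨ sum-cong-≗ (λ a → trans (sym (*-distribˡ-sum (𝟙 (adj G x a)) (λ w → 𝟙 (adj G a w))))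
                                  (cong (𝟙 (adj G x a) *_) (regular a))) ⟩
    ∑[ a < n ] (𝟙 (adj G x a) * k)                        ≡⟨ sym (*-distribʳ-sum k (λ a → 𝟙 (adj G x a))) ⟩
    count (adj G x) * k                                   ≡⟨ cong (_* k) (regular x) ⟩
    k * k                                                 ∎
    where open ≡-Reasoning

  private
    covered : ∀ {S S′ : Fin n → Bool} w → (∀ a → adj G w a ≡ true → 𝟙 (S a) + 𝟙 (S′ a) ≤ 1) →
              ∀ a → 𝟙 (adj G w a ∧ S a) + 𝟙 (adj G w a ∧ S′ a) ≤ 𝟙 (adj G w a)
    covered w disjoint a with adj G w a in wa
    ... | true = disjoint a wa
    ... | false = z≤n

  degreeIn-+ : ∀ {S S′ : Fin n → Bool} w → (∀ a → adj G w a ≡ true → 𝟙 (S a) + 𝟙 (S′ a) ≤ 1) →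
               degreeIn S w + degreeIn S′ w ≤ count (adj G w)
  degreeIn-+ {S} {S′} w disjoint =
    ≤-trans (≤-reflexive (sym (∑-distrib-+ (λ a → 𝟙 (adj G w a ∧ S a)) (λ a → 𝟙 (adj G w a ∧ S′ a)))))
            (sum-mono (covered w disjoint))

  degreeIn-+-tight : ∀ {S S′ : Fin n → Bool} w → (∀ a → adj G w a ≡ true → 𝟙 (S a) + 𝟙 (S′ a) ≤ 1) →
                     degreeIn S w + degreeIn S′ w ≡ count (adj G w) →
                     ∀ a → adj G w a ≡ true → 𝟙 (S a) + 𝟙 (S′ a) ≡ 1
  degreeIn-+-tight {S} {S′} w disjoint full a wa =
    subst (λ b → 𝟙 (b ∧ S a) + 𝟙 (b ∧ S′ a) ≡ 𝟙 b) wa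
      (sum-mono-tight (covered w disjoint)
        (≤-reflexive (trans (sym full)
                            (sym (∑-distrib-+ (λ a → 𝟙 (adj G w a ∧ S a)) (λ a → 𝟙 (adj G w a ∧ S′ a)))))) a)

  degreeIn-+-≡ : ∀ {S S′ : Fin n → Bool} w → (∀ a → adj G w a ≡ true → 𝟙 (S a) + 𝟙 (S′ a) ≡ 1) →
                 degreeIn S w + degreeIn S′ w ≡ count (adj G w)
  degreeIn-+-≡ {S} {S′} w partition =
    trans (sym (∑-distrib-+ (λ a → 𝟙 (adj G w a ∧ S a)) (λ a → 𝟙 (adj G w a ∧ S′ a))))
          (sum-cong-≗ pointwise)
    where
    pointwise : ∀ a → 𝟙 (adj G w a ∧ S a) + 𝟙 (adj G w a ∧ S′ a) ≡ 𝟙 (adj G w a)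
    pointwise a with adj G w a in wa
    ... | true = partition a wa
    ... | false = refl

-- Counting around an edge of a triangle-free regular graph

module Counting {n} (G : Graph n) {k l : ℕ} (regular : ∀ w → count (adj G w) ≡ k)
                (triangleFree : TriangleFree G) (cycles : EdgeInCycles G 4 l) where

  module _ {u v} (uv : adj G u v ≡ true) where

    private
      Closes AtU AtV : Fin n → Fin n → Bool
      Closes a w = isCycle G (u ∷ v ∷ a ∷ w ∷ [])
      AtU a w = ⌊ a ≟ u ⌋ ∧ adj G u w
      AtV a w = not ⌊ a ≟ u ⌋ ∧ (⌊ w ≟ v ⌋ ∧ adj G v a)

      walk-cases : ∀ a w (a≟u : Dec (a ≡ u)) (w≟v : Dec (w ≡ v)) →
                   𝟙 (adj G v a ∧ (adj G a w ∧ adj G w u))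
                     ≤ 𝟙 (Closes a w) + 𝟙 (⌊ a≟u ⌋ ∧ adj G u w) + 𝟙 (not ⌊ a≟u ⌋ ∧ (⌊ w≟v ⌋ ∧ adj G v a))
      walk-cases a w (yes refl) _ =
        ≤-trans (𝟙-mono λ walk → proj₁ (∧-true (proj₂ (∧-true {adj G v a} walk))))
                (≤-trans (m≤n+m _ (𝟙 (Closes a w))) (m≤m+n _ _))
      walk-cases a w (no _) (yes _) = ≤-trans (𝟙-mono {b = adj G v a} λ walk → proj₁ (∧-true walk)) (m≤n+m _ _)
      walk-cases a w (no a≢u) (no w≢v) = ≤-trans (𝟙-mono cycle) (≤-trans (m≤m+n _ _) (m≤m+n _ _))
        where
        cycle : adj G v a ∧ (adj G a w ∧ adj G w u) ≡ true → Closes a w ≡ true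
        cycle walk = let va , aw∧wu = ∧-true {adj G v a} walk ; aw , wu = ∧-true {adj G a w} aw∧wu
                      in isCycle₄ G uv va aw wu a≢u w≢v

      ∑Closes : ∑[ a < n ] ∑[ w < n ] 𝟙 (Closes a w) ≡ l
      ∑Closes = trans (sym (cyclesThrough₄ G u v)) (cycles u v uv)

      ∑AtU : ∑[ a < n ] ∑[ w < n ] 𝟙 (AtU a w) ≡ k
      ∑AtU = begin
        ∑[ a < n ] ∑[ w < n ] 𝟙 (AtU a w)
          ≡⟨ sum-single (λ a → ∑[ w < n ] 𝟙 (AtU a w)) u
               (λ a a≢u → sum-zero (λ w → 𝟙 (AtU a w)) λ w → cong (λ b → 𝟙 (b ∧ adj G u w)) (≟-≢ a≢u)) ⟩
        ∑[ w < n ] 𝟙 (AtU u w)  ≡⟨ sum-cong-≗ (λ w → cong (λ b → 𝟙 (b ∧ adj G u w)) (≟-refl u)) ⟩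
        count (adj G u)         ≡⟨ regular u ⟩
        k                       ∎
        where open ≡-Reasoning

      ∑AtV : suc (∑[ a < n ] ∑[ w < n ] 𝟙 (AtV a w)) ≡ k
      ∑AtV = begin
        suc (∑[ a < n ] ∑[ w < n ] 𝟙 (AtV a w))
          ≡⟨ cong suc (sum-cong-≗ λ a → sum-single (λ w → 𝟙 (AtV a w)) v λ w w≢v →
                 cong 𝟙 (trans (cong (λ b → not ⌊ a ≟ u ⌋ ∧ (b ∧ adj G v a)) (≟-≢ w≢v)) (∧-zeroʳ _))) ⟩
        suc (∑[ a < n ] 𝟙 (AtV a v))
          ≡⟨ cong suc (sum-cong-≗ λ a → cong (λ b → 𝟙 (not ⌊ a ≟ u ⌋ ∧ (b ∧ adj G v a))) (≟-refl v)) ⟩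
        suc (∑[ a < n ] 𝟙 (not ⌊ a ≟ u ⌋ ∧ adj G v a))
          ≡⟨ cong (_+ ∑[ a < n ] 𝟙 (not ⌊ a ≟ u ⌋ ∧ adj G v a)) (sym atU) ⟩
        ∑[ a < n ] 𝟙 (⌊ a ≟ u ⌋ ∧ adj G v a) + ∑[ a < n ] 𝟙 (not ⌊ a ≟ u ⌋ ∧ adj G v a)
          ≡⟨ sym (∑-distrib-+ (λ a → 𝟙 (⌊ a ≟ u ⌋ ∧ adj G v a)) (λ a → 𝟙 (not ⌊ a ≟ u ⌋ ∧ adj G v a))) ⟩
        ∑[ a < n ] (𝟙 (⌊ a ≟ u ⌋ ∧ adj G v a) + 𝟙 (not ⌊ a ≟ u ⌋ ∧ adj G v a))
          ≡⟨ sum-cong-≗ (λ a → sym (𝟙-split (adj G v a) ⌊ a ≟ u ⌋)) ⟩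
        count (adj G v) ≡⟨ regular v ⟩
        k               ∎
        where
        open ≡-Reasoning
        atU : ∑[ a < n ] 𝟙 (⌊ a ≟ u ⌋ ∧ adj G v a) ≡ 1
        atU = trans (sum-single (λ a → 𝟙 (⌊ a ≟ u ⌋ ∧ adj G v a)) u
                       λ a a≢u → cong (λ b → 𝟙 (b ∧ adj G v a)) (≟-≢ a≢u))
                    (cong₂ (λ b c → 𝟙 (b ∧ c)) (≟-refl u) (adj-swap G uv))

    walks₃-bound : suc (walks₃ G v u) ≤ l + k + k
    walks₃-bound = begin
      suc (walks₃ G v u)
        ≤⟨ s≤s (sum-mono λ a → sum-mono λ w → walk-cases a w (a ≟ u) (w ≟ v)) ⟩
      suc (∑[ a < n ] ∑[ w < n ] (𝟙 (Closes a w) + 𝟙 (AtU a w) + 𝟙 (AtV a w)))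
        ≡⟨ cong suc (trans (sum-cong-≗ λ a → ∑-distrib-+₃ (λ w → 𝟙 (Closes a w)) (λ w → 𝟙 (AtU a w)) (λ w → 𝟙 (AtV a w)))
                           (∑-distrib-+₃ (λ a → ∑[ w < n ] 𝟙 (Closes a w)) (λ a → ∑[ w < n ] 𝟙 (AtU a w))
                                         (λ a → ∑[ w < n ] 𝟙 (AtV a w)))) ⟩
      suc (l′ + k′ + ∑[ a < n ] ∑[ w < n ] 𝟙 (AtV a w))
        ≡⟨ sym (+-suc (l′ + k′) _) ⟩
      l′ + k′ + suc (∑[ a < n ] ∑[ w < n ] 𝟙 (AtV a w))
        ≡⟨ cong₂ _+_ (cong₂ _+_ ∑Closes ∑AtU) ∑AtV ⟩
      l + k + k ∎
      where
      open ≤-Reasoning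
      l′ = ∑[ a < n ] ∑[ w < n ] 𝟙 (Closes a w)
      k′ = ∑[ a < n ] ∑[ w < n ] 𝟙 (AtU a w)

    neighbourhood-partition : ∀ w → 𝟙 (adj G u w) + 𝟙 (adj G v w) + 𝟙 (Outside G u v w) ≡ 1
    neighbourhood-partition w with adj G u w in uw | adj G v w in vw
    ... | true | true = ⊥-elim (triangleFree u v w uv vw (adj-swap G uw))
    ... | true | false = refl
    ... | false | true = refl
    ... | false | false = refl

    order : k + k + count (Outside G u v) ≡ n
    order = begin
      k + k + count (Outside G u v)
        ≡⟨ cong (_+ count (Outside G u v)) (sym (cong₂ _+_ (regular u) (regular v))) ⟩
      count (adj G u) + count (adj G v) + count (Outside G u v)
        ≡⟨ sym (∑-distrib-+₃ (λ w → 𝟙 (adj G u w)) (λ w → 𝟙 (adj G v w)) (λ w → 𝟙 (Outside G u v w))) ⟩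
      ∑[ w < n ] (𝟙 (adj G u w) + 𝟙 (adj G v w) + 𝟙 (Outside G u v w))
        ≡⟨ sum-cong-≗ neighbourhood-partition ⟩
      ∑[ w < n ] 1 ≡⟨ sum-const n 1 ⟩
      n * 1        ≡⟨ *-identityʳ n ⟩
      n            ∎
      where open ≡-Reasoning

    neighbourhoods-disjoint : ∀ a → 𝟙 (adj G u a) + 𝟙 (adj G v a) ≤ 1
    neighbourhoods-disjoint a with adj G u a in ua | adj G v a in va
    ... | true | true = ⊥-elim (triangleFree u v a uv va (adj-swap G ua))
    ... | true | false = ≤-refl
    ... | false | true = ≤-refl
    ... | false | false = z≤n

    innerDegree≤ : ∀ w → innerDegree G u v w ≤ k
    innerDegree≤ w = ≤-trans (degreeIn-+ G w λ a _ → neighbourhoods-disjoint a) (≤-reflexive (regular w))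

    innerDegree-inU : ∀ w → adj G u w ≡ true → innerDegree G u v w ≡ degreeIn G (adj G v) w
    innerDegree-inU w uw = cong (_+ degreeIn G (adj G v) w) (sum-zero _ noCommon)
      where
      noCommon : ∀ a → 𝟙 (adj G w a ∧ adj G u a) ≡ 0
      noCommon a with adj G w a in wa | adj G u a in ua
      ... | true | true = ⊥-elim (triangleFree u a w ua (adj-swap G wa) (adj-swap G uw))
      ... | true | false = refl
      ... | false | _ = refl

  module _ {u v} (uv : adj G u v ≡ true) where

    -- Summing innerDegree over all w counts the 2k² edges leaving N(u) ∪ N(v); those ending in
    -- N(u) or N(v) are the walks v a w u, resp. u a w v.
    excess-bound : suc (suc (k * k + k * k))
                   ≤ (l + k + k) + (l + k + k) + ∑[ w < n ] (𝟙 (Outside G u v w) * innerDegree G u v w)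
    excess-bound = let open ≤-Reasoning in begin
      suc (suc (k * k + k * k))
        ≡⟨ cong (2 +_) (sym (trans (∑-distrib-+ (degreeIn G (adj G u)) (degreeIn G (adj G v)))
                                   (cong₂ _+_ (∑degreeIn G regular u) (∑degreeIn G regular v)))) ⟩
      suc (suc (∑[ w < n ] innerDegree G u v w))
        ≡⟨ cong (2 +_) (trans (sum-cong-≗ split) (∑-distrib-+₃ inU inV inR)) ⟩
      suc (suc (sum inU + sum inV + sum inR))
        ≡⟨ cong suc (cong (_+ sum inR) (sym (+-suc (sum inU) (sum inV)))) ⟩
      suc (sum inU) + suc (sum inV) + sum inR
        ≡⟨ cong (_+ sum inR) (cong₂ (λ x y → suc x + suc y) walksVU walksUV) ⟩
      suc (walks₃ G v u) + suc (walks₃ G u v) + sum inR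
        ≤⟨ +-monoˡ-≤ (sum inR) (+-mono-≤ (walks₃-bound uv) (walks₃-bound (adj-swap G uv))) ⟩
      (l + k + k) + (l + k + k) + sum inR ∎
      where
      X = innerDegree G u v
      inU inV inR : Fin n → ℕ
      inU w = 𝟙 (adj G u w) * X w
      inV w = 𝟙 (adj G v w) * X w
      inR w = 𝟙 (Outside G u v w) * X w

      split : ∀ w → X w ≡ inU w + inV w + inR w
      split w = let open ≡-Reasoning in begin
        X w                                                        ≡⟨ sym (*-identityˡ (X w)) ⟩
        1 * X w                                                    ≡⟨ cong (_* X w) (sym (neighbourhood-partition uv w)) ⟩
        (𝟙 (adj G u w) + 𝟙 (adj G v w) + 𝟙 (Outside G u v w)) * X w
          ≡⟨ *-distribʳ-+ (X w) (𝟙 (adj G u w) + 𝟙 (adj G v w)) (𝟙 (Outside G u v w)) ⟩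
        (𝟙 (adj G u w) + 𝟙 (adj G v w)) * X w + inR w
          ≡⟨ cong (_+ inR w) (*-distribʳ-+ (X w) (𝟙 (adj G u w)) (𝟙 (adj G v w))) ⟩
        inU w + inV w + inR w                                      ∎

      walksVU : sum inU ≡ walks₃ G v u
      walksVU = trans (sum-cong-≗ λ w → 𝟙-*-cong (adj G u w) (innerDegree-inU uv w)) (sym (walks₃≡ G v u))

      walksUV : sum inV ≡ walks₃ G u v
      walksUV = trans (sum-cong-≗ λ w → 𝟙-*-cong (adj G v w) λ vw →
                         trans (+-comm (degreeIn G (adj G u) w) (degreeIn G (adj G v) w))
                               (innerDegree-inU (adj-swap G uv) w vw))
                      (sym (walks₃≡ G u v))

    excess≤ : ∑[ w < n ] (𝟙 (Outside G u v w) * innerDegree G u v w) ≤ count (Outside G u v) * k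
    excess≤ = ≤-trans (sum-mono λ w → *-monoʳ-≤ (𝟙 (Outside G u v w)) (innerDegree≤ uv w))
                      (≤-reflexive (sym (*-distribʳ-sum k (λ w → 𝟙 (Outside G u v w)))))

record EGR₆₄₁₆ {n} (G : Graph n) : Set where
  field
    regular : ∀ w → count (adj G w) ≡ 6
    triangleFree : TriangleFree G
    cycles : EdgeInCycles G 4 16
    {u v} : Fin n
    uv : adj G u v ≡ true

fromIsEGR : ∀ {n} {G : Graph n} → IsEGR G 6 4 16 → EGR₆₄₁₆ G
fromIsEGR {G = G} (_ , regular , girth , cycles) = record
  { regular = λ w → trans (sym (degree≡count G w)) (regular w)
  ; triangleFree = girth4⇒triangleFree G girth
  ; cycles = cycles
  ; uv = proj₂ (proj₂ (cycle⇒edge G {2} (proj₁ (proj₁ girth)) (proj₂ (proj₁ girth))))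
  }

swapEdge : ∀ {n} {G : Graph n} → EGR₆₄₁₆ G → EGR₆₄₁₆ G
swapEdge {G = G} egr = record { EGR₆₄₁₆ egr hiding (u; v; uv) ; uv = adj-swap G (EGR₆₄₁₆.uv egr) }

module _ {n} {G : Graph n} (egr : EGR₆₄₁₆ G) where
  open EGR₆₄₁₆ egr
  open Counting G regular triangleFree cycles

  three≤outside : 3 ≤ count (Outside G u v)
  three≤outside = arithmetic (≤-trans (excess-bound uv) (+-monoʳ-≤ 56 (excess≤ uv)))
    where
    arithmetic : ∀ {r} → 74 ≤ 56 + r * 6 → 3 ≤ r
    arithmetic {0} le = ⊥-elim (≤⇒≤ᵇ le)
    arithmetic {1} le = ⊥-elim (≤⇒≤ᵇ le)
    arithmetic {2} le = ⊥-elim (≤⇒≤ᵇ le)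
    arithmetic {suc (suc (suc r))} _ = s≤s (s≤s (s≤s z≤n))

  fifteen≤order : 15 ≤ n
  fifteen≤order = subst (15 ≤_) (order uv) (+-monoʳ-≤ 12 three≤outside)

-- The extremal case

module Extremal {n} {G : Graph n} (egr : EGR₆₄₁₆ G)
                (outside≡3 : count (Outside G (EGR₆₄₁₆.u egr) (EGR₆₄₁₆.v egr)) ≡ 3) where
  open EGR₆₄₁₆ egr
  open Counting G regular triangleFree cycles

  A B R : Fin n → Bool
  A = adj G u
  B = adj G v
  R = Outside G u v

  some-outside : Σ[ r ∈ Fin n ] R r ≡ true
  some-outside = count-pos R (subst (0 <_) (sym outside≡3) (s≤s z≤n))

  outside-saturated : ∀ r → R r ≡ true → innerDegree G u v r ≡ 6
  outside-saturated r Rr =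
    trans (sym (*-identityˡ _)) (trans (subst (λ b → 𝟙 b * innerDegree G u v r ≡ 𝟙 b * 6) Rr (tight r))
                                       (*-identityˡ 6))
    where
    tight : ∀ w → 𝟙 (R w) * innerDegree G u v w ≡ 𝟙 (R w) * 6
    tight = sum-mono-tight (λ w → *-monoʳ-≤ (𝟙 (R w)) (innerDegree≤ uv w))
              (≤-trans (≤-reflexive (trans (sym (*-distribʳ-sum 6 (λ w → 𝟙 (R w)))) (cong (_* 6) outside≡3)))
                       (+-cancelˡ-≤ 56 _ _ (excess-bound uv)))

  outside-neighbour-inside : ∀ r s → R r ≡ true → adj G r s ≡ true → 𝟙 (A s) + 𝟙 (B s) ≡ 1
  outside-neighbour-inside r s Rr =
    degreeIn-+-tight G r (λ a _ → neighbourhoods-disjoint uv a) (trans (outside-saturated r Rr) (sym (regular r))) s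

  outside-independent : ∀ r s → R r ≡ true → R s ≡ true → adj G r s ≡ false
  outside-independent r s Rr Rs with adj G r s in rs
  ... | false = refl
  ... | true with () ← subst₂ (λ a b → 𝟙 a + 𝟙 b ≡ 1) (proj₁ (Outside⇒nonadjacent G Rs))
                               (proj₂ (Outside⇒nonadjacent G Rs)) (outside-neighbour-inside r s Rr rs)

  B-degree<6 : ∀ r → R r ≡ true → degreeIn G B r < 6
  B-degree<6 r Rr = ≤-trans (sum-mono-< u (λ a → 𝟙-mono (proj₂ ∘ ∧-true {adj G r a})) atU) (≤-reflexive (regular v))
    where
    atU : 𝟙 (adj G r u ∧ adj G v u) < 𝟙 (adj G v u)
    atU rewrite adj-swap G (proj₁ (Outside⇒nonadjacent G Rr)) | adj-swap G uv = s≤s z≤n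

  A-neighbour : ∀ r → R r ≡ true → Σ[ x ∈ Fin n ] (adj G u x ≡ true × adj G x r ≡ true)
  A-neighbour r Rr =
    let x , rx∧ux = count-pos (λ a → adj G r a ∧ A a) positive ; rx , ux = ∧-true {adj G r x} rx∧ux
    in x , ux , adj-swap G rx
    where
    positive : 0 < degreeIn G A r
    positive with degreeIn G A r in A≡
    ... | suc _ = s≤s z≤n
    ... | zero = ⊥-elim (<-irrefl (trans (cong (_+ degreeIn G B r) (sym A≡)) (outside-saturated r Rr))
                                  (B-degree<6 r Rr))

  B-or-R : ∀ x → adj G u x ≡ true → degreeIn G B x + degreeIn G R x ≡ 6
  B-or-R x ux = trans (degreeIn-+-≡ G x exactlyOne) (regular x)
    where
    exactlyOne : ∀ a → adj G x a ≡ true → 𝟙 (B a) + 𝟙 (R a) ≡ 1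
    exactlyOne a xa with adj G u a in ua
    ... | true = ⊥-elim (triangleFree u x a ux xa (adj-swap G ua))
    ... | false with adj G v a
    ...   | true = refl
    ...   | false = refl

  adjacent-B-degrees≤6 : ∀ x r → adj G x r ≡ true → degreeIn G B r + degreeIn G B x ≤ 6
  adjacent-B-degrees≤6 x r xr = begin
    degreeIn G B r + degreeIn G B x                  ≡⟨ cong₂ _+_ (degreeIn-comm G v r) (degreeIn-comm G v x) ⟩
    degreeIn G (adj G r) v + degreeIn G (adj G x) v  ≤⟨ degreeIn-+ G v disjoint ⟩
    count (adj G v)                                   ≡⟨ regular v ⟩
    6                                                 ∎
    where
    open ≤-Reasoning
    disjoint : ∀ a → adj G v a ≡ true → 𝟙 (adj G r a) + 𝟙 (adj G x a) ≤ 1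
    disjoint a _ with adj G r a in ra | adj G x a in xa
    ... | true | true = ⊥-elim (triangleFree x r a xr ra (adj-swap G xa))
    ... | true | false = ≤-refl
    ... | false | true = ≤-refl
    ... | false | false = z≤n

  B-degree≤R-degree : ∀ x r → adj G u x ≡ true → adj G x r ≡ true → degreeIn G B r ≤ degreeIn G R x
  B-degree≤R-degree x r ux xr = +-cancelʳ-≤ (degreeIn G B x) _ _
    (≤-trans (adjacent-B-degrees≤6 x r xr) (≤-reflexive (trans (sym (B-or-R x ux)) (+-comm (degreeIn G B x) _))))

  R-degree≤3 : ∀ x → degreeIn G R x ≤ 3
  R-degree≤3 x = ≤-trans (count-mono λ w → proj₂ ∘ ∧-true {adj G x w}) (≤-reflexive outside≡3)

  B-degree≤3 : ∀ r → R r ≡ true → degreeIn G B r ≤ 3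
  B-degree≤3 r Rr = let x , ux , xr = A-neighbour r Rr in ≤-trans (B-degree≤R-degree x r ux xr) (R-degree≤3 x)

  sees-all-outside : ∀ x r → adj G u x ≡ true → adj G x r ≡ true → degreeIn G B r ≡ 3 →
                     ∀ w → R w ≡ true → adj G x w ≡ true
  sees-all-outside x r ux xr B≡3 w Rw =
    proj₁ (∧-true (count-mono-tight (λ w → proj₂ ∘ ∧-true {adj G x w}) R≤ w Rw))
    where
    R≤ : count R ≤ degreeIn G R x
    R≤ = ≤-trans (≤-reflexive (trans outside≡3 (sym B≡3))) (B-degree≤R-degree x r ux xr)

  twin-of-v : ∀ x → adj G u x ≡ true → degreeIn G R x ≡ 0 → Twins G x v
  twin-of-v x ux R≡0 w = ⇔→≡ {z = true} (mk⇔ (proj₂ ∘ ∧-true ∘ tight (adj G x) (proj₁ ∘ ∧-true) (regular x) w)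
                                             (proj₁ ∘ ∧-true ∘ tight B (proj₂ ∘ ∧-true) (regular v) w))
    where
    B≡6 : degreeIn G B x ≡ 6
    B≡6 = trans (sym (+-identityʳ _)) (trans (cong (degreeIn G B x +_) (sym R≡0)) (B-or-R x ux))
    tight : ∀ Q → (∀ {w} → adj G x w ∧ B w ≡ true → Q w ≡ true) → count Q ≡ 6 →
            ∀ w → Q w ≡ true → adj G x w ∧ B w ≡ true
    tight Q P⇒Q Q≡6 = count-mono-tight (λ _ → P⇒Q) (≤-reflexive (trans Q≡6 (sym B≡6)))

  module _ (B≡3 : ∀ r → R r ≡ true → degreeIn G B r ≡ 3) where

    A-sees-outside : ∀ x → adj G u x ≡ true → ¬ Twins G x v → ∀ w → R w ≡ true → adj G x w ≡ true
    A-sees-outside x ux ¬twin with degreeIn G R x in R-degree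
    ... | zero = ⊥-elim (¬twin (twin-of-v x ux R-degree))
    ... | suc _ with count-pos (λ w → adj G x w ∧ R w) (subst (0 <_) (sym R-degree) (s≤s z≤n))
    ...   | r , xr∧Rr = let xr , Rr = ∧-true {adj G x r} xr∧Rr in sees-all-outside x r ux xr (B≡3 r Rr)

    -- Twins of u lie in B but miss every vertex of R, so they avoid the three B-neighbours of r.
    twins-of-u≤3 : count (λ t → ⌊ twins? G t u ⌋) ≤ 3
    twins-of-u≤3 = +-cancelˡ-≤ 3 _ _ (begin
      3 + count (λ t → ⌊ twins? G t u ⌋)
        ≤⟨ +-mono-≤ (≤-reflexive (sym (B≡3 r Rr)))
                    (count-mono {Q = λ t → not (adj G r t) ∧ B t} λ t → twin⇒ {t} ∘ isYes⇒ {d = twins? G t u}) ⟩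
      count (λ t → adj G r t ∧ B t) + count (λ t → not (adj G r t) ∧ B t)
        ≡⟨ sym (∑-distrib-+ (λ t → 𝟙 (adj G r t ∧ B t)) (λ t → 𝟙 (not (adj G r t) ∧ B t))) ⟩
      ∑[ t < n ] (𝟙 (adj G r t ∧ B t) + 𝟙 (not (adj G r t) ∧ B t))
        ≡⟨ sum-cong-≗ (λ t → sym (𝟙-split (B t) (adj G r t))) ⟩
      count B ≡⟨ regular v ⟩
      6       ∎)
      where
      open ≤-Reasoning
      r = proj₁ some-outside
      Rr = proj₂ some-outside
      twin⇒ : ∀ {t} → Twins G t u → not (adj G r t) ∧ B t ≡ true
      twin⇒ {t} twin rewrite adj-swap G (trans (twin r) (proj₁ (Outside⇒nonadjacent G Rr)))
                          | adj-swap G (trans (twin v) uv) = refl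

module Structure {n} {G : Graph n} (egr : EGR₆₄₁₆ G)
                 (outside≡3 : count (Outside G (EGR₆₄₁₆.u egr) (EGR₆₄₁₆.v egr)) ≡ 3) where
  open EGR₆₄₁₆ egr
  open Extremal egr outside≡3 public using (A; B; R; some-outside; outside-independent)
  private
    module UV = Extremal egr outside≡3
    module VU = Extremal (swapEdge egr) (trans (sum-cong-≗ λ w → cong 𝟙 (Outside-comm G u v w)) outside≡3)

    toVU : ∀ {w} → R w ≡ true → VU.R w ≡ true
    toVU {w} = trans (Outside-comm G u v w)

    fromVU : ∀ {w} → VU.R w ≡ true → R w ≡ true
    fromVU {w} = trans (sym (Outside-comm G u v w))

    half : ∀ {a b} → a + b ≡ 6 → a ≤ 3 → b ≤ 3 → a ≡ 3
    half {a} {b} a+b≡6 a≤3 b≤3 =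
      ≤-antisym a≤3 (+-cancelʳ-≤ b 3 a (≤-trans (+-monoʳ-≤ 3 b≤3) (≤-reflexive (sym a+b≡6))))

  A-degree≡3 : ∀ r → R r ≡ true → degreeIn G A r ≡ 3
  A-degree≡3 r Rr = half (UV.outside-saturated r Rr) (VU.B-degree≤3 r (toVU Rr)) (UV.B-degree≤3 r Rr)

  B-degree≡3 : ∀ r → R r ≡ true → degreeIn G B r ≡ 3
  B-degree≡3 r Rr = half (trans (+-comm (degreeIn G B r) _) (UV.outside-saturated r Rr))
                         (UV.B-degree≤3 r Rr) (VU.B-degree≤3 r (toVU Rr))

  private
    A-degree≡3′ : ∀ r → VU.R r ≡ true → degreeIn G A r ≡ 3
    A-degree≡3′ r = A-degree≡3 r ∘ fromVU

  A-sees-outside : ∀ x → adj G u x ≡ true → ¬ Twins G x v → ∀ w → R w ≡ true → adj G x w ≡ true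
  A-sees-outside = UV.A-sees-outside B-degree≡3

  B-sees-outside : ∀ y → adj G v y ≡ true → ¬ Twins G y u → ∀ w → R w ≡ true → adj G y w ≡ true
  B-sees-outside y vy ¬twin w = VU.A-sees-outside A-degree≡3′ y vy ¬twin w ∘ toVU

  twins-of-u≤3 : count (λ t → ⌊ twins? G t u ⌋) ≤ 3
  twins-of-u≤3 = UV.twins-of-u≤3 B-degree≡3

  twins-of-v≤3 : count (λ t → ⌊ twins? G t v ⌋) ≤ 3
  twins-of-v≤3 = VU.twins-of-u≤3 A-degree≡3′

-- The blow-up C₅[3]

C₅ : Graph 5
C₅ = record
  { adj = λ i j → next i j ∨ next j i
  ; sym = λ i j → ∨-comm (next i j) (next j i)
  ; irrefl = next-irrefl
  }
  where
  next : Fin 5 → Fin 5 → Bool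
  next i j = (toℕ i + 1) % 5 ≡ᵇ toℕ j
  next-irrefl : ∀ i → next i i ∨ next i i ≡ false
  next-irrefl 0F = refl
  next-irrefl 1F = refl
  next-irrefl 2F = refl
  next-irrefl 3F = refl
  next-irrefl 4F = refl

blowUp : ∀ {m} → Graph m → (t : ℕ) → Graph (m * t)
blowUp H t = record
  { adj = λ a b → adj H (quotient t a) (quotient t b)
  ; sym = λ a b → adj-sym H (quotient t a) (quotient t b)
  ; irrefl = λ a → irrefl H (quotient t a)
  }

blowUp-combine : ∀ {m} (H : Graph m) t i j i′ j′ → adj (blowUp H t) (combine i j) (combine i′ j′) ≡ adj H i i′
blowUp-combine H t i j i′ j′ =
  cong₂ (adj H) (cong proj₁ (remQuot-combine i j)) (cong proj₁ (remQuot-combine i′ j′))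

K : Graph 15
K = blowUp C₅ 3

K-vertex : Fin 5 → Fin 3 → Fin 15
K-vertex = combine

blowUp-triangleFree : ∀ {m} (H : Graph m) t → TriangleFree H → TriangleFree (blowUp H t)
blowUp-triangleFree H t triangleFree a b c = triangleFree (quotient t a) (quotient t b) (quotient t c)

C₅-triangleFree : TriangleFree C₅
C₅-triangleFree = toWitness {a? = all? λ a → all? λ b → all? λ c →
  (adj C₅ a b Bool.≟ true) →-dec ((adj C₅ b c Bool.≟ true) →-dec ((adj C₅ c a Bool.≟ true) →-dec no λ ()))} _

diameter≤2⇒connected : ∀ {n} (G : Graph n) →
  (∀ a b → ∃[ c ] adj G a c ≡ true × (c ≡ b ⊎ adj G c b ≡ true)) → Connected G
diameter≤2⇒connected G near a b with near a b
... | c , ac , inj₁ refl = step ac here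
... | c , ac , inj₂ cb = step ac (step cb here)

K-connected : Connected K
K-connected = diameter≤2⇒connected K (toWitness {a? = all? λ a → all? λ b → any? λ c →
  (adj K a c Bool.≟ true) ×-dec ((c ≟ b) ⊎-dec (adj K c b Bool.≟ true))} _)

K-regular : Regular K 6
K-regular = toWitness {a? = all? λ a → degree K a ℕ.≟ 6} _

K-girth : Girth K 4
K-girth = (square , refl) , triangleFree⇒noShortCycle K (blowUp-triangleFree C₅ 3 C₅-triangleFree)
  where
  square = K-vertex 0F 0F ∷ K-vertex 1F 0F ∷ K-vertex 0F 1F ∷ K-vertex 1F 1F ∷ []

K-cycles : EdgeInCycles K 4 16
K-cycles u v uv = trans (cyclesThrough₄ K u v) (toWitness {a? = all? λ u → all? λ v →
  (adj K u v Bool.≟ true) →-dec (∑[ x < 15 ] ∑[ y < 15 ] 𝟙 (isCycle K (u ∷ v ∷ x ∷ y ∷ [])) ℕ.≟ 16)} _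
    u v uv)

K-egr : IsEGR K 6 4 16
K-egr = K-connected , K-regular , K-girth , K-cycles

K-nonbipartite : ¬ Bipartite K
K-nonbipartite =
  pentagon⇒¬Bipartite K {K-vertex 0F 0F} {K-vertex 1F 0F} {K-vertex 2F 0F} {K-vertex 3F 0F} {K-vertex 4F 0F}
                      refl refl refl refl refl

-- Classification of the vertices of an extremal graph

module Classification {n} {G : Graph n} (egr : EGR₆₄₁₆ G)
                      (outside≡3 : count (Outside G (EGR₆₄₁₆.u egr) (EGR₆₄₁₆.v egr)) ≡ 3) where
  open EGR₆₄₁₆ egr
  open Structure egr outside≡3

  data Class (w : Fin n) : Fin 5 → Set where
    twin-u : Twins G w u → Class w 0F
    twin-v : Twins G w v → Class w 1F
    in-B   : ¬ Twins G w u → B w ≡ true → Class w 2F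
    in-R   : R w ≡ true → Class w 3F
    in-A   : ¬ Twins G w v → A w ≡ true → Class w 4F

  classify : ∀ w → Σ (Fin 5) (Class w)
  classify w with twins? G w u | twins? G w v | B w in Bw | A w in Aw
  ... | yes t | _ | _ | _ = 0F , twin-u t
  ... | no _ | yes t | _ | _ = 1F , twin-v t
  ... | no ¬t | no _ | true | _ = 2F , in-B ¬t Bw
  ... | no _ | no ¬t | false | true = 4F , in-A ¬t Aw
  ... | no _ | no _ | false | false = 3F , in-R (cong₂ (λ a b → not a ∧ not b) Aw Bw)

  class : Fin n → Fin 5
  class w = proj₁ (classify w)

  private
    A⇒¬B : ∀ {a} → A a ≡ true → B a ≡ false
    A⇒¬B {a} Aa with B a in Ba
    ... | false = refl
    ... | true = ⊥-elim (triangleFree u v a uv Ba (adj-swap G Aa))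

    B⇒¬A : ∀ {a} → B a ≡ true → A a ≡ false
    B⇒¬A {a} Ba with A a in Aa
    ... | false = refl
    ... | true = ⊥-elim (triangleFree u v a uv Ba (adj-swap G Aa))

    common-neighbour⇒nonadjacent : ∀ {c a b} → adj G c a ≡ true → adj G c b ≡ true → adj G a b ≡ false
    common-neighbour⇒nonadjacent {c} {a} {b} ca cb with adj G a b in ab
    ... | false = refl
    ... | true = ⊥-elim (triangleFree c a b ca ab (adj-swap G cb))

    r₀ = proj₁ some-outside
    Rr₀ = proj₂ some-outside

    BA-nonadjacent : ∀ {a b} → ¬ Twins G a u → B a ≡ true → ¬ Twins G b v → A b ≡ true → adj G a b ≡ false
    BA-nonadjacent ¬ta Ba ¬tb Ab = common-neighbour⇒nonadjacent (adj-swap G (B-sees-outside _ Ba ¬ta r₀ Rr₀))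
                                                                 (adj-swap G (A-sees-outside _ Ab ¬tb r₀ Rr₀))

    nonadjacent-twins : ∀ {a x} → Twins G a x → adj G x a ≡ false
    nonadjacent-twins {a} {x} ta = adj-swap G (trans (ta x) (irrefl G x))

  adj-by-class : ∀ {a b i j} → Class a i → Class b j → adj G a b ≡ adj C₅ i j
  adj-by-class (twin-u ta) (twin-u tb) = trans (ta _) (nonadjacent-twins tb)
  adj-by-class (twin-u ta) (twin-v tb) = trans (ta _) (adj-swap G (trans (tb u) (adj-swap G uv)))
  adj-by-class (twin-u ta) (in-B _ Bb) = trans (ta _) (B⇒¬A Bb)
  adj-by-class (twin-u ta) (in-R Rb) = trans (ta _) (proj₁ (Outside⇒nonadjacent G Rb))
  adj-by-class (twin-u ta) (in-A _ Ab) = trans (ta _) Ab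
  adj-by-class (twin-v ta) (twin-u tb) = trans (ta _) (adj-swap G (trans (tb v) uv))
  adj-by-class (twin-v ta) (twin-v tb) = trans (ta _) (nonadjacent-twins tb)
  adj-by-class (twin-v ta) (in-B _ Bb) = trans (ta _) Bb
  adj-by-class (twin-v ta) (in-R Rb) = trans (ta _) (proj₂ (Outside⇒nonadjacent G Rb))
  adj-by-class (twin-v ta) (in-A _ Ab) = trans (ta _) (A⇒¬B Ab)
  adj-by-class (in-B _ Ba) (twin-u tb) = adj-swap G (trans (tb _) (B⇒¬A Ba))
  adj-by-class (in-B _ Ba) (twin-v tb) = adj-swap G (trans (tb _) Ba)
  adj-by-class (in-B _ Ba) (in-B _ Bb) = common-neighbour⇒nonadjacent Ba Bb
  adj-by-class (in-B ¬ta Ba) (in-R Rb) = B-sees-outside _ Ba ¬ta _ Rb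
  adj-by-class (in-B ¬ta Ba) (in-A ¬tb Ab) = BA-nonadjacent ¬ta Ba ¬tb Ab
  adj-by-class (in-R Ra) (twin-u tb) = adj-swap G (trans (tb _) (proj₁ (Outside⇒nonadjacent G Ra)))
  adj-by-class (in-R Ra) (twin-v tb) = adj-swap G (trans (tb _) (proj₂ (Outside⇒nonadjacent G Ra)))
  adj-by-class (in-R Ra) (in-B ¬tb Bb) = adj-swap G (B-sees-outside _ Bb ¬tb _ Ra)
  adj-by-class (in-R Ra) (in-R Rb) = outside-independent _ _ Ra Rb
  adj-by-class (in-R Ra) (in-A ¬tb Ab) = adj-swap G (A-sees-outside _ Ab ¬tb _ Ra)
  adj-by-class (in-A _ Aa) (twin-u tb) = adj-swap G (trans (tb _) Aa)
  adj-by-class (in-A _ Aa) (twin-v tb) = adj-swap G (trans (tb _) (A⇒¬B Aa))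
  adj-by-class (in-A ¬ta Aa) (in-B ¬tb Bb) = adj-swap G (BA-nonadjacent ¬tb Bb ¬ta Aa)
  adj-by-class (in-A ¬ta Aa) (in-R Rb) = A-sees-outside _ Aa ¬ta _ Rb
  adj-by-class (in-A _ Aa) (in-A _ Ab) = common-neighbour⇒nonadjacent Aa Ab

  adj-class : ∀ a b → adj G a b ≡ adj C₅ (class a) (class b)
  adj-class a b = adj-by-class (proj₂ (classify a)) (proj₂ (classify b))

  private
    Member : Fin 5 → Fin n → Bool
    Member 0F w = ⌊ twins? G w u ⌋
    Member 1F w = ⌊ twins? G w v ⌋
    Member 2F w = adj G r₀ w ∧ B w
    Member 3F w = R w
    Member 4F w = adj G r₀ w ∧ A w

    member : ∀ {w i} → Class w i → Member i w ≡ true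
    member {w} (twin-u t) = isYes⇐ (twins? G w u) t
    member {w} (twin-v t) = isYes⇐ (twins? G w v) t
    member (in-B ¬t Bw) = cong₂ _∧_ (adj-swap G (B-sees-outside _ Bw ¬t r₀ Rr₀)) Bw
    member (in-R Rw) = Rw
    member (in-A ¬t Aw) = cong₂ _∧_ (adj-swap G (A-sees-outside _ Aw ¬t r₀ Rr₀)) Aw

    Member≤3 : ∀ i → count (Member i) ≤ 3
    Member≤3 0F = twins-of-u≤3
    Member≤3 1F = twins-of-v≤3
    Member≤3 2F = ≤-reflexive (B-degree≡3 r₀ Rr₀)
    Member≤3 3F = ≤-reflexive outside≡3
    Member≤3 4F = ≤-reflexive (A-degree≡3 r₀ Rr₀)

  class-size : ∀ i → count (λ w → ⌊ class w ≟ i ⌋) ≤ 3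
  class-size i = ≤-trans (count-mono {Q = Member i} λ w same →
                            subst (λ j → Member j w ≡ true) (isYes⇒ same) (member (proj₂ (classify w))))
                         (Member≤3 i)

  rank : Fin n → ℕ
  rank w = count (λ t → ⌊ class t ≟ class w ⌋ ∧ ⌊ t <ᶠ? w ⌋)

  rank<3 : ∀ w → rank w < 3
  rank<3 w = ≤-trans (sum-mono-< w (λ t → 𝟙-mono (proj₁ ∘ ∧-true)) self) (class-size (class w))
    where
    self : 𝟙 (⌊ class w ≟ class w ⌋ ∧ ⌊ w <ᶠ? w ⌋) < 𝟙 ⌊ class w ≟ class w ⌋
    self rewrite ≟-refl (class w) | isNo⇐ (w <ᶠ? w) (<ᶠ-irrefl refl) = s≤s z≤n

  rank-mono : ∀ {a b} → class a ≡ class b → a <ᶠ b → rank a < rank b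
  rank-mono {a} {b} same a<b = sum-mono-< a (λ t → 𝟙-mono (earlier t)) atA
    where
    earlier : ∀ t → ⌊ class t ≟ class a ⌋ ∧ ⌊ t <ᶠ? a ⌋ ≡ true → ⌊ class t ≟ class b ⌋ ∧ ⌊ t <ᶠ? b ⌋ ≡ true
    earlier t e = let ta , t<a = ∧-true {⌊ class t ≟ class a ⌋} e in
      cong₂ _∧_ (isYes⇐ (class t ≟ class b) (trans (isYes⇒ ta) same))
                (isYes⇐ (t <ᶠ? b) (<ᶠ-trans (isYes⇒ t<a) a<b))
    atA : 𝟙 (⌊ class a ≟ class a ⌋ ∧ ⌊ a <ᶠ? a ⌋) < 𝟙 (⌊ class a ≟ class b ⌋ ∧ ⌊ a <ᶠ? b ⌋)
    atA rewrite isNo⇐ (a <ᶠ? a) (<ᶠ-irrefl refl) | ∧-zeroʳ ⌊ class a ≟ class a ⌋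
              | isYes⇐ (class a ≟ class b) same | isYes⇐ (a <ᶠ? b) a<b = s≤s z≤n

  embed : Fin n → Fin 15
  embed w = K-vertex (class w) (fromℕ< (rank<3 w))

  embed-injective : ∀ {a b} → embed a ≡ embed b → a ≡ b
  embed-injective {a} {b} eq with combine-injective (class a) _ (class b) _ eq
  ... | same , position = trichotomy (<ᶠ-cmp a b)
    where
    rank≡ : rank a ≡ rank b
    rank≡ = trans (sym (toℕ-fromℕ< (rank<3 a))) (trans (cong toℕ position) (toℕ-fromℕ< (rank<3 b)))
    trichotomy : Tri (a <ᶠ b) (a ≡ b) (b <ᶠ a) → a ≡ b
    trichotomy (tri< a<b _ _) = ⊥-elim (<-irrefl rank≡ (rank-mono same a<b))
    trichotomy (tri≈ _ a≡b _) = a≡b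
    trichotomy (tri> _ _ b<a) = ⊥-elim (<-irrefl (sym rank≡) (rank-mono (sym same) b<a))

  embed-adj : ∀ a b → adj K (embed a) (embed b) ≡ adj G a b
  embed-adj a b = trans (blowUp-combine C₅ 3 (class a) _ (class b) _) (sym (adj-class a b))

  order≡15 : n ≡ 15
  order≡15 = trans (sym (Counting.order G regular triangleFree cycles uv)) (cong (12 +_) outside≡3)

  embed-surjective : ∀ y → Σ[ x ∈ Fin n ] embed x ≡ y
  embed-surjective y with any? (λ x → embed x ≟ y)
  ... | yes hit = hit
  ... | no miss = ⊥-elim (<-irrefl refl (subst (_≤ 14) order≡15 (injective⇒≤ avoid-injective)))
    where
    avoid : Fin n → Fin 14
    avoid x = punchOut {i = y} {j = embed x} λ e → miss (x , sym e)
    avoid-injective : ∀ {a b} → avoid a ≡ avoid b → a ≡ b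
    avoid-injective {a} {b} =
      embed-injective ∘ punchOut-injective (λ e → miss (a , sym e)) (λ e → miss (b , sym e))

  ≅K : Isomorphic G K
  ≅K = ⤖⇒↔ (mk⤖ (embed-injective , strictlySurjective⇒surjective embed-surjective)) , embed-adj

egr₁₅≅K : (G : Graph 15) → IsEGR G 6 4 16 → Isomorphic G K
egr₁₅≅K G isEGR =
  Classification.≅K egr (+-cancelˡ-≡ 12 _ _ (Counting.order G regular triangleFree cycles uv))
  where
  egr = fromIsEGR isEGR
  open EGR₆₄₁₆ egr

mainTheorem11 : NEq 6 4 16 15
    × ((G H : Graph 15) → IsEGR G 6 4 16 → IsEGR H 6 4 16 → Isomorphic G H)
    × ((G : Graph 15) → IsEGR G 6 4 16 → ¬ Bipartite G)
mainTheorem11 =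
  ((K , K-egr) , λ w w<15 G isEGR → <⇒≱ w<15 (fifteen≤order (fromIsEGR isEGR))) ,
  (λ G H G-egr H-egr → ≅-trans {G = G} {K} {H} (egr₁₅≅K G G-egr) (≅-sym {G = H} {K} (egr₁₅≅K H H-egr))) ,
  (λ G G-egr → K-nonbipartite ∘ Bipartite-pullback {G = K} {G} (≅-sym {G = G} {K} (egr₁₅≅K G G-egr)))
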